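{- Let $\mathcal{O}$ be an annotated $\mathcal{ELH}^r$ ontology, $\alpha$ an axiom and $m$ a monomial. Let $\mathcal{O}'$ be obtained from $\mathcal{O}$ by exhaustively applying the normalisation rules $\mathsf{NF}_1$–$\mathsf{NF}_3$ below. Then: (1) if $\mathcal{O}\models(\alpha,m)$, then $\mathcal{O}'\models(\alpha,m)$; (2) if $\mathcal{O}'\models(\alpha,m)$ and every concept name occurring in $\alpha$ occurs in $\mathcal{O}$, then $\mathcal{O}\models(\alpha,m)$. Normalisation rules, where $\widehat{C},\widehat{D}$ denote concepts not in $N_C\cup\{\top\}$, $C,E$ are concepts, $R\in N_R$, $v$ is the annotation, and $A$ is a fresh concept name (not occurring in the current ontology) each time a rule is applied: $\mathsf{NF}_1$: replace $(C\sqcap\widehat{D}\sqsubseteq E,v)$ by $(\widehat{D}\sqsubseteq A,1)$ and $(C\sqcap A\sqsubseteq E,v)$; $\mathsf{NF}_2$: replace $(\exists R.\widehat{C}\sqsubseteq D,v)$ by $(\widehat{C}\sqsubseteq A,1)$ and $(\exists R.A\sqsubseteq D,v)$; $\mathsf{NF}_3$: replace $(\widehat{C}\sqsubseteq \exists R,v)$ by $(\widehat{C}\sqsubseteq A,1)$ and $(A\sqsubseteq\exists R,v)$.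
   Context: Fix pairwise disjoint countably infinite sets $N_C$ (concept names), $N_R$ (role names), $N_I$ (individual names), $N_V$ (provenance variables). A monomial is a finite product of variables from $N_V$ (the empty product is $1$); $N_M$ is the set of monomials. Products are computed in the Trio semiring: $\times$ is commutative, associative and idempotent ($v\times v=v$), so monomials $m,n$ are equivalent, $m\approx n$, iff they contain the same set of variables; the representative $[m]$ is the product of the distinct variables of $m$ in lexicographic order. $\mathcal{ELH}^r$ concepts: $C::=A\mid\exists R.C\mid C\sqcap C\mid\top$ ($A\in N_C$, $R\in N_R$). Axioms are GCIs $C\sqsubseteq D$ with $C$ a concept and $D::=A\mid\exists R$; role inclusions $R\sqsubseteq S$; range restrictions ${\sf ran}(R)\sqsubseteq A$; assertions $A(a)$, $R(a,b)$ ($a,b\in N_I$). An annotated axiom is a pair $(\alpha,m)$, $m\in N_M$. An annotated $\mathcal{ELH}^r$ ontology is a finite set of annotated axioms $(\alpha,v)$ with $v\in N_V\cup\{1\}$. An annotated interpretation $\mathcal{I}=(\Delta^\mathcal{I},\Delta^\mathcal{I}_{m},\cdot^\mathcal{I})$ consists of non-empty disjoint sets $\Delta^\mathcal{I},\Delta^\mathcal{I}_m$ and a map with $a^\mathcal{I}\in\Delta^\mathcal{I}$, $A^\mathcal{I}\subseteq\Delta^\mathcal{I}\times\Delta^\mathcal{I}_m$, $R^\mathcal{I}\subseteq\Delta^\mathcal{I}\times\Delta^\mathcal{I}\times\Delta^\mathcal{I}_m$, and $m^\mathcal{I}\in\Delta^\mathcal{I}_m$ for each monomial with $m^\mathcal{I}=n^\mathcal{I}$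 iff $m\approx n$. It is extended by: $\top^\mathcal{I}=\Delta^\mathcal{I}\times\{1^\mathcal{I}\}$; $(\exists R)^\mathcal{I}=\{(d,\mu)\mid\exists e\,(d,e,\mu)\in R^\mathcal{I}\}$; $({\sf ran}(R))^\mathcal{I}=\{(e,\mu)\mid\exists d\,(d,e,\mu)\in R^\mathcal{I}\}$; $(C\sqcap D)^\mathcal{I}=\{(d,(m\times n)^\mathcal{I})\mid(d,m^\mathcal{I})\in C^\mathcal{I},(d,n^\mathcal{I})\in D^\mathcal{I}\}$; $(\exists R.C)^\mathcal{I}=\{(d,(m\times n)^\mathcal{I})\mid\exists e\,(d,e,m^\mathcal{I})\in R^\mathcal{I},(e,n^\mathcal{I})\in C^\mathcal{I}\}$. $\mathcal{I}$ satisfies $(R\sqsubseteq S,m)$ if for all $n\in N_M$, $(d,e,n^\mathcal{I})\in R^\mathcal{I}$ implies $(d,e,(m\times n)^\mathcal{I})\in S^\mathcal{I}$; $(G\sqsubseteq D,m)$ ($G$ a concept or ${\sf ran}(R)$, $D$ a concept) if for all $n$, $(d,n^\mathcal{I})\in G^\mathcal{I}$ implies $(d,(m\times n)^\mathcal{I})\in D^\mathcal{I}$; $(A(a),m)$ if $(a^\mathcal{I},m^\mathcal{I})\in A^\mathcal{I}$; $(R(a,b),m)$ if $(a^\mathcal{I},b^\mathcal{I},m^\mathcal{I})\in R^\mathcal{I}$. $\mathcal{I}$ is a model of $\mathcal{O}$ if it satisfies all its annotated axioms; $\mathcal{O}\models(\alpha,m)$ if every model of $\mathcal{O}$ satisfies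 $(\alpha,m)$. -}

module Defs where

open import Data.Nat using (ℕ)
open import Data.List using (List; []; _∷_; _++_)
open import Data.List.Membership.Propositional using (_∈_; _∉_)
open import Data.List.Relation.Unary.All using (All)
open import Data.Maybe using (Maybe; just; nothing)
open import Data.Product using (Σ; ∃; ∃-syntax; _×_; _,_)
open import Function.Bundles using (_⇔_)
open import Relation.Binary.PropositionalEquality using (_≡_)
open import Relation.Binary.Construct.Closure.ReflexiveTransitive using (Star)
open import Relation.Nullary using (¬_)

ConceptName = ℕ
RoleName    = ℕ
IndName     = ℕ
Var         = ℕ

Monomial : Set
Monomial = List Var

_≈ₘ_ : Monomial → Monomial → Set
m ≈ₘ n = ∀ x → (x ∈ m) ⇔ (x ∈ n)

_×ₘ_ : Monomial → Monomial → Monomial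
m ×ₘ n = m ++ n

data Concept : Set where
  conc : ConceptName → Concept
  ex   : RoleName → Concept → Concept
  _⊓_  : Concept → Concept → Concept
  ⊤c   : Concept

data RHS : Set where
  atom : ConceptName → RHS
  some : RoleName → RHS

data Axiom : Set where
  gci     : Concept → RHS → Axiom
  rinc    : RoleName → RoleName → Axiom
  ran     : RoleName → ConceptName → Axiom
  cassert : ConceptName → IndName → Axiom
  rassert : RoleName → IndName → IndName → Axiom

-- annotations of ontology axioms: v ∈ N_V ∪ {1}; nothing stands for 1
Annot : Set
Annot = Maybe Var

annotMon : Annot → Monomial
annotMon nothing  = []
annotMon (just v) = v ∷ []

AnnAxiom : Set
AnnAxiom = Axiom × Annot

Ontology : Set
Ontology = List AnnAxiom

record Interpretation : Set₁ where
  field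
    Δ     : Set
    Δm    : Set
    elt   : Δ                      -- Δ non-empty (Δm non-empty via 1^I)
    ind   : IndName → Δ
    cn    : ConceptName → Δ → Δm → Set
    rn    : RoleName → Δ → Δ → Δm → Set
    mon   : Monomial → Δm
    mon-≡ : ∀ m n → (mon m ≡ mon n) ⇔ (m ≈ₘ n)
  -- (Δ and Δm are distinct types, hence disjoint.)

module _ (I : Interpretation) where
  open Interpretation I

  ⟦_⟧ : Concept → Δ → Δm → Set
  ⟦ conc A ⟧ d μ = cn A d μ
  ⟦ ⊤c ⟧ d μ = μ ≡ mon []
  ⟦ C ⊓ D ⟧ d μ =
    ∃[ m ] ∃[ n ] (⟦ C ⟧ d (mon m) × ⟦ D ⟧ d (mon n) × μ ≡ mon (m ×ₘ n))
  ⟦ ex R C ⟧ d μ =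
    ∃[ e ] ∃[ m ] ∃[ n ] (rn R d e (mon m) × ⟦ C ⟧ e (mon n) × μ ≡ mon (m ×ₘ n))

  ⟦_⟧ʳ : RHS → Δ → Δm → Set
  ⟦ atom A ⟧ʳ d μ = cn A d μ
  ⟦ some R ⟧ʳ d μ = ∃[ e ] rn R d e μ

  ⟦ran_⟧ : RoleName → Δ → Δm → Set
  ⟦ran R ⟧ e μ = ∃[ d ] rn R d e μ

  Sat : Axiom → Monomial → Set
  Sat (gci C D) m = ∀ n d → ⟦ C ⟧ d (mon n) → ⟦ D ⟧ʳ d (mon (m ×ₘ n))
  Sat (rinc R S) m = ∀ n d e → rn R d e (mon n) → rn S d e (mon (m ×ₘ n))
  Sat (ran R A) m = ∀ n e → ⟦ran R ⟧ e (mon n) → cn A e (mon (m ×ₘ n))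
  Sat (cassert A a) m = cn A (ind a) (mon m)
  Sat (rassert R a b) m = rn R (ind a) (ind b) (mon m)

Model : Interpretation → Ontology → Set
Model I O = All (λ { (α , v) → Sat I α (annotMon v) }) O

_⊨_,_ : Ontology → Axiom → Monomial → Set₁
O ⊨ α , m = (I : Interpretation) → Model I O → Sat I α m

namesC : Concept → List ConceptName
namesC (conc A) = A ∷ []
namesC (ex R C) = namesC C
namesC (C ⊓ D) = namesC C ++ namesC D
namesC ⊤c = []

namesR : RHS → List ConceptName
namesR (atom A) = A ∷ []
namesR (some R) = []

namesA : Axiom → List ConceptName
namesA (gci C D) = namesC C ++ namesR D
namesA (rinc R S) = []
namesA (ran R A) = A ∷ []
namesA (cassert A a) = A ∷ []
namesA (rassert R a b) = []

namesO : Ontology → List ConceptName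
namesO [] = []
namesO ((α , v) ∷ O) = namesA α ++ namesO O

data Complex : Concept → Set where
  cx-⊓  : ∀ C D → Complex (C ⊓ D)
  cx-ex : ∀ R C → Complex (ex R C)

-- Rule ax new₁ new₂ A : ax is replaced by new₁, new₂ using the name A
data Rule : AnnAxiom → AnnAxiom → AnnAxiom → ConceptName → Set where
  nf1ʳ : ∀ {C D E v A} → Complex D →
    Rule (gci (C ⊓ D) E , v) (gci D (atom A) , nothing) (gci (C ⊓ conc A) E , v) A
  -- ⊓ is read modulo commutativity: also the conjunct on the left
  nf1ˡ : ∀ {C D E v A} → Complex D →
    Rule (gci (D ⊓ C) E , v) (gci D (atom A) , nothing) (gci (conc A ⊓ C) E , v) A
  nf2  : ∀ {R C D v A} → Complex C →
    Rule (gci (ex R C) D , v) (gci C (atom A) , nothing) (gci (ex R (conc A)) D , v) A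
  nf3  : ∀ {R C v A} → Complex C →
    Rule (gci C (some R) , v) (gci C (atom A) , nothing) (gci (conc A) (some R) , v) A

data Step : Ontology → Ontology → Set where
  step : ∀ {L₁ L₂ ax n₁ n₂ A} → Rule ax n₁ n₂ A →
    A ∉ namesO (L₁ ++ ax ∷ L₂) →
    Step (L₁ ++ ax ∷ L₂) (L₁ ++ n₁ ∷ n₂ ∷ L₂)

Normalises : Ontology → Ontology → Set
Normalises O O' = Star Step O O' × (¬ (∃[ O'' ] Step O' O''))

-- The two new axioms of a rule entail the replaced one, so every model of the
-- normal form is a model of O. Conversely, a model of O becomes a model of the
-- normal form once the fresh name A is reinterpreted as the extension, with its
-- provenance, of the complex concept that A abbreviates; since A occurs neither
-- in the current ontology nor in α, the reinterpretation affects neither the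
-- remaining axioms nor (α, m). Normalisation never removes a concept name, so
-- the condition on the names of α persists along the whole derivation.
module Submission where

open import Defs
open import Data.Product using (_×_; _,_; proj₁)
open import Data.List.Membership.Propositional using (_∈_; _∉_)
open import Data.List.Relation.Unary.All as All using (All; []; _∷_; lookup)

open import Data.Nat using (_≟_)
open import Data.Nat.Properties using (≟-diag)
open import Data.List using (List; []; _∷_; _++_)
open import Data.List.Properties using (++-assoc)
open import Data.List.Membership.Propositional.Properties using (∈-++⁻; ∈-++⁺ˡ; ∈-++⁺ʳ)
open import Data.List.Relation.Binary.Subset.Propositional using (_⊆_)
open import Data.List.Relation.Binary.Subset.Propositional.Properties
  using (⊆-reflexive; ⊆-trans; xs⊆xs++ys; xs⊆ys++xs; ++⁺ˡ; ++⁺ʳ)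
open import Data.List.Relation.Unary.All.Properties using (++⁺; ++⁻ˡ; ++⁻ʳ)
open import Data.List.Relation.Unary.Any using (here; there)
open import Data.Sum using (inj₁; inj₂)
open import Function using (id; _∘_)
open import Function.Bundles using (_⇔_; mk⇔; module Equivalence)
open Equivalence using (to; from)
open import Relation.Nullary.Decidable using (yes; no; dec-no)
open import Relation.Binary.PropositionalEquality using (_≡_; _≢_; refl; sym; subst)
open import Relation.Binary.Construct.Closure.ReflexiveTransitive using (Star; ε; _◅_)

All-replace : ∀ {a p} {X : Set a} {P : X → Set p} xs {ys zs ws : List X} →
  (All P ys → All P zs) → All P (xs ++ ys ++ ws) → All P (xs ++ zs ++ ws)
All-replace []       {ys} f ps        = ++⁺ (f (++⁻ˡ ys ps)) (++⁻ʳ ys ps)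
All-replace (_ ∷ xs)      f (px ∷ ps) = px ∷ All-replace xs f ps

namesO-++ : ∀ O₁ O₂ → namesO (O₁ ++ O₂) ≡ namesO O₁ ++ namesO O₂
namesO-++ []              O₂ = refl
namesO-++ ((α , _) ∷ O₁) O₂ rewrite namesO-++ O₁ O₂ =
  sym (++-assoc (namesA α) (namesO O₁) (namesO O₂))

namesA⊆namesO : ∀ O₁ {ax O₂} → namesA (proj₁ ax) ⊆ namesO (O₁ ++ ax ∷ O₂)
namesA⊆namesO []              = xs⊆xs++ys _ _
namesA⊆namesO ((α , _) ∷ O₁) = ∈-++⁺ʳ (namesA α) ∘ namesA⊆namesO O₁

reinterpret : (I : Interpretation) →
  (ConceptName → Interpretation.Δ I → Interpretation.Δm I → Set) → Interpretation
reinterpret I c = record I { cn = c }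

module Reinterpretation (I : Interpretation) where
  open Interpretation I

  Extension : Set₁
  Extension = ConceptName → Δ → Δm → Set

  _⊑[_]_ : Extension → List ConceptName → Extension → Set
  c ⊑[ ns ] c' = ∀ {B} → B ∈ ns → ∀ {d μ} → c B d μ → c' B d μ

  ⊑-⊆ : ∀ {c c' xs ys} → xs ⊆ ys → c ⊑[ ys ] c' → c ⊑[ xs ] c'
  ⊑-⊆ xs⊆ys c⊑c' B∈xs = c⊑c' (xs⊆ys B∈xs)

  ⟦⟧-mono : ∀ C {c c'} → c ⊑[ namesC C ] c' →
    ∀ {d μ} → ⟦_⟧ (reinterpret I c) C d μ → ⟦_⟧ (reinterpret I c') C d μ
  ⟦⟧-mono (conc B) c⊑c' x = c⊑c' (here refl) x
  ⟦⟧-mono (ex R C) c⊑c' (e , m , n , r , x , eq) = e , m , n , r , ⟦⟧-mono C c⊑c' x , eq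
  ⟦⟧-mono (C ⊓ D)  c⊑c' (m , n , x , y , eq) =
    m , n , ⟦⟧-mono C (⊑-⊆ (xs⊆xs++ys _ _) c⊑c') x , ⟦⟧-mono D (⊑-⊆ (xs⊆ys++xs _ _) c⊑c') y , eq
  ⟦⟧-mono ⊤c       c⊑c' x = x

  ⟦⟧ʳ-mono : ∀ D {c c'} → c ⊑[ namesR D ] c' →
    ∀ {d μ} → ⟦_⟧ʳ (reinterpret I c) D d μ → ⟦_⟧ʳ (reinterpret I c') D d μ
  ⟦⟧ʳ-mono (atom B) c⊑c' x = c⊑c' (here refl) x
  ⟦⟧ʳ-mono (some R) c⊑c' x = x

  Sat-transfer : ∀ α {m c c'} → c ⊑[ namesA α ] c' → c' ⊑[ namesA α ] c →
    Sat (reinterpret I c) α m → Sat (reinterpret I c') α m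
  Sat-transfer (gci C D) c⊑c' c'⊑c s n d x =
    ⟦⟧ʳ-mono D (⊑-⊆ (xs⊆ys++xs _ _) c⊑c') (s n d (⟦⟧-mono C (⊑-⊆ (xs⊆xs++ys _ _) c'⊑c) x))
  Sat-transfer (rinc R S)      _    _ s = s
  Sat-transfer (ran R A)       c⊑c' _ s n e r = c⊑c' (here refl) (s n e r)
  Sat-transfer (cassert A a)   c⊑c' _ s = c⊑c' (here refl) s
  Sat-transfer (rassert R a b) _    _ s = s

  Model-transfer : ∀ O {c c'} → c ⊑[ namesO O ] c' → c' ⊑[ namesO O ] c →
    Model (reinterpret I c) O → Model (reinterpret I c') O
  Model-transfer []             _    _    []      = []
  Model-transfer ((α , _) ∷ O) c⊑c' c'⊑c (s ∷ M) =
    Sat-transfer α (⊑-⊆ (xs⊆xs++ys _ _) c⊑c') (⊑-⊆ (xs⊆xs++ys _ _) c'⊑c) s ∷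
    Model-transfer O (⊑-⊆ (xs⊆ys++xs _ _) c⊑c') (⊑-⊆ (xs⊆ys++xs _ _) c'⊑c) M

  update : ConceptName → (Δ → Δm → Set) → Extension → Extension
  update A P c B with B ≟ A
  ... | yes _ = P
  ... | no  _ = c B

  update-at : ∀ A P c → update A P c A ≡ P
  update-at A P c rewrite ≟-diag {A} refl = refl

  update-elsewhere : ∀ {A B} P c → B ≢ A → update A P c B ≡ c B
  update-elsewhere {A} {B} P c B≢A rewrite dec-no (B ≟ A) B≢A = refl

  update-⊑ : ∀ {A P c ns} → A ∉ ns → c ⊑[ ns ] update A P c
  update-⊑ {P = P} {c} A∉ns B∈ns {d} {μ} =
    subst (λ Q → Q d μ) (sym (update-elsewhere P c λ { refl → A∉ns B∈ns }))

  update-⊒ : ∀ {A P c ns} → A ∉ ns → update A P c ⊑[ ns ] c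
  update-⊒ {P = P} {c} A∉ns B∈ns {d} {μ} =
    subst (λ Q → Q d μ) (update-elsewhere P c λ { refl → A∉ns B∈ns })

abbreviated : ∀ {ax n₁ n₂ A} → Rule ax n₁ n₂ A → Concept
abbreviated (nf1ʳ {D = D} _) = D
abbreviated (nf1ˡ {D = D} _) = D
abbreviated (nf2  {C = C} _) = C
abbreviated (nf3  {C = C} _) = C

DefinedAs : (I : Interpretation) → ConceptName → Concept → Set
DefinedAs I A C = ∀ {d μ} → ⟦_⟧ I C d μ ⇔ Interpretation.cn I A d μ

rule-sound : ∀ {I ax n₁ n₂ A} → Rule ax n₁ n₂ A →
  Model I (n₁ ∷ n₂ ∷ []) → Model I (ax ∷ [])
rule-sound (nf1ʳ _) (s₁ ∷ s₂ ∷ []) =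
  (λ n d → λ { (p , q , x , y , eq) → s₂ n d (p , q , x , s₁ q d y , eq) }) ∷ []
rule-sound (nf1ˡ _) (s₁ ∷ s₂ ∷ []) =
  (λ n d → λ { (p , q , y , x , eq) → s₂ n d (p , q , s₁ p d y , x , eq) }) ∷ []
rule-sound (nf2 _) (s₁ ∷ s₂ ∷ []) =
  (λ n d → λ { (e , p , q , r , x , eq) → s₂ n d (e , p , q , r , s₁ q e x , eq) }) ∷ []
rule-sound (nf3 _) (s₁ ∷ s₂ ∷ []) = (λ n d x → s₂ n d (s₁ n d x)) ∷ []

rule-complete : ∀ {I ax n₁ n₂ A} (r : Rule ax n₁ n₂ A) → DefinedAs I A (abbreviated r) →
  Model I (ax ∷ []) → Model I (n₁ ∷ n₂ ∷ [])
rule-complete (nf1ʳ _) A≡D (s ∷ []) =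
  (λ n d → to A≡D) ∷
  (λ n d → λ { (p , q , x , a , eq) → s n d (p , q , x , from A≡D a , eq) }) ∷ []
rule-complete (nf1ˡ _) A≡D (s ∷ []) =
  (λ n d → to A≡D) ∷
  (λ n d → λ { (p , q , a , x , eq) → s n d (p , q , from A≡D a , x , eq) }) ∷ []
rule-complete (nf2 _) A≡C (s ∷ []) =
  (λ n d → to A≡C) ∷
  (λ n d → λ { (e , p , q , r , a , eq) → s n d (e , p , q , r , from A≡C a , eq) }) ∷ []
rule-complete (nf3 _) A≡C (s ∷ []) =
  (λ n d → to A≡C) ∷ (λ n d a → s n d (from A≡C a)) ∷ []

abbreviated-names : ∀ {ax n₁ n₂ A} (r : Rule ax n₁ n₂ A) →
  namesC (abbreviated r) ⊆ namesA (proj₁ ax)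
abbreviated-names (nf1ʳ {C} {D} _) = xs⊆xs++ys _ _ ∘ xs⊆ys++xs _ (namesC C)
abbreviated-names (nf1ˡ _)         = xs⊆xs++ys _ _ ∘ xs⊆xs++ys _ _
abbreviated-names (nf2 _)          = xs⊆xs++ys _ _
abbreviated-names (nf3 _)          = xs⊆xs++ys _ _

rule-names : ∀ {ax n₁ n₂ A} → Rule ax n₁ n₂ A →
  namesA (proj₁ ax) ⊆ namesA (proj₁ n₁) ++ namesA (proj₁ n₂)
rule-names (nf1ʳ {C} {D} _) B∈ with ∈-++⁻ (namesC C ++ namesC D) B∈
... | inj₂ B∈E = ∈-++⁺ʳ (namesC D ++ _) (∈-++⁺ʳ (namesC C ++ _) B∈E)
... | inj₁ B∈CD with ∈-++⁻ (namesC C) B∈CD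
...   | inj₁ B∈C = ∈-++⁺ʳ (namesC D ++ _) (∈-++⁺ˡ (∈-++⁺ˡ B∈C))
...   | inj₂ B∈D = ∈-++⁺ˡ (∈-++⁺ˡ B∈D)
rule-names (nf1ˡ {C} {D} _) B∈ with ∈-++⁻ (namesC D ++ namesC C) B∈
... | inj₂ B∈E = ∈-++⁺ʳ (namesC D ++ _) (∈-++⁺ʳ (_ ∷ namesC C) B∈E)
... | inj₁ B∈DC with ∈-++⁻ (namesC D) B∈DC
...   | inj₁ B∈D = ∈-++⁺ˡ (∈-++⁺ˡ B∈D)
...   | inj₂ B∈C = ∈-++⁺ʳ (namesC D ++ _) (∈-++⁺ˡ (there B∈C))
rule-names (nf2 {C = C} _) B∈ with ∈-++⁻ (namesC C) B∈
... | inj₁ B∈C = ∈-++⁺ˡ (∈-++⁺ˡ B∈C)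
... | inj₂ B∈D = ∈-++⁺ʳ (namesC C ++ _) (there B∈D)
rule-names (nf3 {C = C} _) B∈ with ∈-++⁻ (namesC C) B∈
... | inj₁ B∈C = ∈-++⁺ˡ (∈-++⁺ˡ B∈C)
... | inj₂ ()

step-names : ∀ {O O₁} → Step O O₁ → namesO O ⊆ namesO O₁
step-names (step {L₁} {L₂} {ax} {n₁} {n₂} r _)
  rewrite namesO-++ L₁ (ax ∷ L₂) | namesO-++ L₁ (n₁ ∷ n₂ ∷ L₂) =
  ++⁺ʳ (namesO L₁) (⊆-trans (++⁺ˡ (namesO L₂) (rule-names r))
                            (⊆-reflexive (++-assoc (namesA (proj₁ n₁)) _ _)))

step-sound : ∀ {I O O₁} → Step O O₁ → Model I O₁ → Model I O
step-sound (step {L₁} r _) = All-replace L₁ (rule-sound r)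

step-conservative : ∀ {O O₁} → Step O O₁ → ∀ α m →
  All (_∈ namesO O) (namesA α) → O₁ ⊨ α , m → O ⊨ α , m
step-conservative (step {L₁} {L₂} {ax} {A = A} r A∉O) α m α⊆O O₁⊨α I M =
  Sat-transfer α (update-⊒ A∉α) (update-⊑ A∉α)
    (O₁⊨α J (All-replace L₁ {ax ∷ []} (rule-complete r A≡Ĉ)
      (Model-transfer (L₁ ++ ax ∷ L₂) (update-⊑ A∉O) (update-⊒ A∉O) M)))
  where
  open Reinterpretation I
  Ĉ = abbreviated r
  J = reinterpret I (update A (⟦_⟧ I Ĉ) (Interpretation.cn I))

  A∉α : A ∉ namesA α
  A∉α = A∉O ∘ lookup α⊆O

  A∉Ĉ : A ∉ namesC Ĉ
  A∉Ĉ = A∉O ∘ namesA⊆namesO L₁ ∘ abbreviated-names r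

  A≡Ĉ : DefinedAs J A Ĉ
  A≡Ĉ {d} {μ} = mk⇔
    (subst (λ P → P d μ) (sym (update-at A _ _)) ∘ ⟦⟧-mono Ĉ (update-⊒ A∉Ĉ))
    (⟦⟧-mono Ĉ (update-⊑ A∉Ĉ) ∘ subst (λ P → P d μ) (update-at A _ _))

star-sound : ∀ {I O O₁} → Star Step O O₁ → Model I O₁ → Model I O
star-sound ε        = id
star-sound (s ◅ ss) = step-sound s ∘ star-sound ss

star-conservative : ∀ {O O₁} → Star Step O O₁ → ∀ α m →
  All (_∈ namesO O) (namesA α) → O₁ ⊨ α , m → O ⊨ α , m
star-conservative ε        α m α⊆O = id
star-conservative (s ◅ ss) α m α⊆O =
  step-conservative s α m α⊆O ∘ star-conservative ss α m (All.map (step-names s) α⊆O)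

theorem1 : (O O' : Ontology) (α : Axiom) (m : Monomial) →
    Normalises O O' →
    ((O ⊨ α , m) → (O' ⊨ α , m)) ×
    ((O' ⊨ α , m) → All (λ A → A ∈ namesO O) (namesA α) → (O ⊨ α , m))
theorem1 O O' α m (steps , _) =
  (λ O⊨α I M → O⊨α I (star-sound steps M)) ,
  (λ O'⊨α α⊆O → star-conservative steps α m α⊆O O'⊨α)
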